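{- Let $F$ be a finite commutative semifield with $|F|=q$. Then there exists a colored $q$-configuration with $q^2$ points and $q^2$ lines.
   Context: A semifield is a set $S$ with operations $+$ and $\cdot$ such that $(S,+)$ is a group with identity $0$; for $a,b\in S$ with $a\ne0$ there are unique $x,y\in S$ with $a\cdot x=b$ and $y\cdot a=b$; both distributive laws $a(b+c)=ab+ac$, $(a+b)c=ac+bc$ hold; and there is $1\ne0$ with $1\cdot a=a\cdot1=a$ for all $a$ (multiplication need not be associative). It is commutative if $a\cdot b=b\cdot a$ for all $a,b$. A $k$-configuration consists of finite sets $P$ (points), $L$ (lines) and an incidence relation $R\subseteq P\times L$ such that: (i) there do not exist distinct $p_1,p_2\in P$ and distinct $l_1,l_2\in L$ with $(p_i,l_j)\in R$ for all $i,j$; (ii) each point is incident with exactly $k$ lines; (iii) each line is incident with exactly $k$ points. Its incidence graph has vertex set $P\sqcup L$ and an edge $\{p,l\}$ for each $(p,l)\in R$; the configuration is connected if this graph is. A $k$-edge coloring assigns one of $k$ colors to each edge so that edges sharing a vertex have distinct colors; $\phi_c(v)$ is the neighbor of $v$ along the edge of color $c$. The 6-cycle property: for every vertex $v$ and distinct colors $a,b,c$, $(\phi_c\phi_b\phi_a\phi_c\phi_b\phi_a)(v)=v$. A colored $k$-configuration is a connected $k$-configuration with a $k$-edge coloring of its incidence graph having the 6-cycle property. -}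

module Defs where

open import Data.Nat using (ℕ)
open import Data.Fin using (Fin)
open import Data.Bool using (Bool; T)
open import Data.Empty using (⊥)
open import Data.Product using (Σ; _×_; _,_)
open import Data.Sum using (_⊎_; inj₁; inj₂)
open import Relation.Nullary using (¬_)
open import Relation.Binary.PropositionalEquality using (_≡_; _≢_)
open import Function.Bundles using (_↔_)

-- Semifields (as in the paper): (S,+) a group with identity 0,
-- unique left/right division by non-zero elements, both distributive
-- laws, and a two-sided identity 1 ≠ 0.  Multiplication need not be
-- associative.

record Semifield : Set₁ where
  infixl 6 _+_
  infixl 7 _·_
  field
    Carrier : Set
    _+_     : Carrier → Carrier → Carrier
    _·_     : Carrier → Carrier → Carrier
    0#      : Carrier
    1#      : Carrier
    -_      : Carrier → Carrier
    +-assoc    : ∀ a b c → (a + b) + c ≡ a + (b + c)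
    +-identityˡ : ∀ a → 0# + a ≡ a
    +-identityʳ : ∀ a → a + 0# ≡ a
    +-inverseˡ  : ∀ a → (- a) + a ≡ 0#
    +-inverseʳ  : ∀ a → a + (- a) ≡ 0#
    left-div  : ∀ a b → a ≢ 0# →
                Σ Carrier (λ x → (a · x ≡ b) × (∀ x′ → a · x′ ≡ b → x′ ≡ x))
    right-div : ∀ a b → a ≢ 0# →
                Σ Carrier (λ y → (y · a ≡ b) × (∀ y′ → y′ · a ≡ b → y′ ≡ y))
    distribˡ : ∀ a b c → a · (b + c) ≡ a · b + a · c
    distribʳ : ∀ a b c → (a + b) · c ≡ a · c + b · c
    1≢0       : 1# ≢ 0#
    ·-identityˡ : ∀ a → 1# · a ≡ a
    ·-identityʳ : ∀ a → a · 1# ≡ a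

IsCommutative : Semifield → Set
IsCommutative F = ∀ a b → a · b ≡ b · a
  where open Semifield F

HasOrder : Semifield → ℕ → Set
HasOrder F q = Semifield.Carrier F ↔ Fin q

record Configuration (m n k : ℕ) : Set where
  field
    inc : Fin m → Fin n → Bool
  I : Fin m → Fin n → Set
  I p l = T (inc p l)
  field
    no-digon : ∀ p₁ p₂ l₁ l₂ → p₁ ≢ p₂ → l₁ ≢ l₂ →
               I p₁ l₁ → I p₁ l₂ → I p₂ l₁ → I p₂ l₂ → ⊥
    point-degree : ∀ p → Σ (Fin n) (λ l → I p l) ↔ Fin k
    line-degree  : ∀ l → Σ (Fin m) (λ p → I p l) ↔ Fin k

module _ {m n k : ℕ} (C : Configuration m n k) where
  open Configuration C

  Vertex : Set
  Vertex = Fin m ⊎ Fin n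

  Adj : Vertex → Vertex → Set
  Adj (inj₁ p) (inj₂ l) = I p l
  Adj (inj₂ l) (inj₁ p) = I p l
  Adj (inj₁ _) (inj₁ _) = ⊥
  Adj (inj₂ _) (inj₂ _) = ⊥

  data Reach : Vertex → Vertex → Set where
    here : ∀ {v} → Reach v v
    step : ∀ {u v w} → Adj u v → Reach v w → Reach u w

  Connected : Set
  Connected = ∀ u v → Reach u v

  record EdgeColoring : Set where
    field
      col : ∀ p l → I p l → Fin k
      proper-at-point : ∀ p l l′ (r : I p l) (r′ : I p l′) →
                        l ≢ l′ → col p l r ≢ col p l′ r′
      proper-at-line  : ∀ l p p′ (r : I p l) (r′ : I p′ l) →
                        p ≢ p′ → col p l r ≢ col p′ l r′

    -- Step c v w : w = φ_c(v), i.e. {v,w} is an edge of colour c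
    Step : Fin k → Vertex → Vertex → Set
    Step c (inj₁ p) (inj₂ l) = Σ (I p l) (λ r → col p l r ≡ c)
    Step c (inj₂ l) (inj₁ p) = Σ (I p l) (λ r → col p l r ≡ c)
    Step c (inj₁ _) (inj₁ _) = ⊥
    Step c (inj₂ _) (inj₂ _) = ⊥

    SixCycle : Set
    SixCycle = ∀ (a b c : Fin k) → a ≢ b → b ≢ c → a ≢ c →
               ∀ v v₁ v₂ v₃ v₄ v₅ v₆ →
               Step a v v₁ → Step b v₁ v₂ → Step c v₂ v₃ →
               Step a v₃ v₄ → Step b v₄ v₅ → Step c v₅ v₆ → v₆ ≡ v

record ColoredConfiguration (m n k : ℕ) : Set where
  field
    config    : Configuration m n k
    connected : Connected config
    coloring  : EdgeColoring config
    six-cycle : EdgeColoring.SixCycle coloring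

{-# OPTIONS --safe #-}
-- Points and lines are both pairs over F: the point (x , y) lies on the line (m , c) iff
-- y + c = x · m, and that edge gets the color x + m.  The neighbor of color k of a pair
-- (u , v), point or line alike thanks to commutativity of ·, is
-- turn k (u , v) = (k − u , u · (k − u) − v).  Two consecutive turns, of colors a then b,
-- form the shear (u , v) ↦ (u + (b − a) , v + (a − u) · (b − a)), and shears compose like
-- translations, shear a b ∘ shear b c = shear a c; this gives the six-cycle property.
-- Two distinct lines meet at most once since right division by m − m′ is unique, and
-- every point (x , y) is joined to the origin through (0 , − y), (1 , y) and (y , 0).
module Submission where

open import Defs
open import Algebra.Bundles using (AbelianGroup; Group)
open import Algebra.Structures using (IsGroup)
open import Data.Product using (_×_; _,_; Σ; proj₁; proj₂)
open import Relation.Binary.PropositionalEquality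
open import Relation.Nullary using (Dec)
open import Relation.Nullary.Decidable using (⌊_⌋; toWitness; fromWitness; via-injection)
open import Relation.Binary.Definitions using (DecidableEquality)
open import Data.Nat using (ℕ; _*_; _^_)
open import Data.Nat.Properties using (*-identityʳ)
open import Data.Fin using (Fin)
import Data.Fin.Properties as Fin
open import Data.Bool using (Bool; T)
open import Data.Bool.Properties using (T-irrelevant)
open import Data.Sum using (inj₁; inj₂)
open import Data.Product.Properties using (Σ-≡,≡→≡)
open import Data.Product.Function.NonDependent.Propositional using (_×-↔_)
open import Function.Base using (_∘_)
open import Function.Bundles using (_↔_; Inverse; Injection; mk↔ₛ′)
open import Function.Construct.Composition using (_↔-∘_)
open import Function.Properties.Inverse using (↔-sym; ↔⇒↣)
import Algebra.Properties.AbelianGroup as AbelianGroupProperties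
import Algebra.Properties.CommutativeSemigroup as CommutativeSemigroupProperties
import Algebra.Properties.Group as GroupProperties

module SemifieldProperties (F : Semifield) where
  open Semifield F
  open ≡-Reasoning

  private
    +-isGroup : IsGroup _≡_ _+_ 0# -_
    +-isGroup = record
      { isMonoid = record
        { isSemigroup = record
          { isMagma = record { isEquivalence = isEquivalence ; ∙-cong = cong₂ _+_ }
          ; assoc = +-assoc }
        ; identity = +-identityˡ , +-identityʳ }
      ; inverse = +-inverseˡ , +-inverseʳ
      ; ⁻¹-cong = cong -_ }

    +-group : Group _ _
    +-group = record { isGroup = +-isGroup }

  -- Not an axiom: expanding (1 + 1)(a + b) by both distributive laws and cancelling.
  +-comm : ∀ a b → a + b ≡ b + a
  +-comm a b = ∙-cancelʳ b (a + b) (b + a) (∙-cancelˡ a _ _ (begin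
      a + ((a + b) + b)   ≡⟨ cong (a +_) (+-assoc a b b) ⟩
      a + (a + (b + b))   ≡⟨ +-assoc a a (b + b) ⟨
      (a + a) + (b + b)   ≡⟨ cong₂ _+_ (two· a) (two· b) ⟨
      two · a + two · b   ≡⟨ distribˡ two a b ⟨
      two · (a + b)       ≡⟨ two· (a + b) ⟩
      (a + b) + (a + b)   ≡⟨ +-assoc a b (a + b) ⟩
      a + (b + (a + b))   ≡⟨ cong (a +_) (+-assoc b a b) ⟨
      a + ((b + a) + b)   ∎))
    where
    open GroupProperties +-group using (∙-cancelˡ; ∙-cancelʳ)
    two : Carrier
    two = 1# + 1#
    two· : ∀ x → two · x ≡ x + x
    two· x = trans (distribʳ 1# 1# x) (cong₂ _+_ (·-identityˡ x) (·-identityˡ x))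

  +-abelianGroup : AbelianGroup _ _
  +-abelianGroup = record { isAbelianGroup = record { isGroup = +-isGroup ; comm = +-comm } }

  open AbelianGroup +-abelianGroup public using (_-_)
  open AbelianGroupProperties +-abelianGroup public
  open CommutativeSemigroupProperties (AbelianGroup.commutativeSemigroup +-abelianGroup) public

  x+[y-x]≡y : ∀ x y → x + (y - x) ≡ y
  x+[y-x]≡y x y = trans (+-comm x (y - x)) (//-rightDividesˡ x y)

  [x-y]+[y-z]≡x-z : ∀ x y z → (x - y) + (y - z) ≡ x - z
  [x-y]+[y-z]≡x-z x y z = trans (+-assoc x (- y) (y - z)) (cong (x +_) (\\-leftDividesʳ y (- z)))

  [x+y]-[x+z]≡y-z : ∀ x y z → (x + y) - (x + z) ≡ y - z
  [x+y]-[x+z]≡y-z x y z = begin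
    (x + y) + - (x + z)     ≡⟨ cong ((x + y) +_) (⁻¹-∙-comm x z) ⟨
    (x + y) + (- x + - z)   ≡⟨ interchange x y (- x) (- z) ⟩
    (x - x) + (y - z)       ≡⟨ cong (_+ (y - z)) (+-inverseʳ x) ⟩
    0# + (y - z)            ≡⟨ +-identityˡ (y - z) ⟩
    y - z                   ∎

  ·-zeroʳ : ∀ a → a · 0# ≡ 0#
  ·-zeroʳ a = identityʳ-unique (a · 0#) (a · 0#) (begin
    a · 0# + a · 0#   ≡⟨ distribˡ a 0# 0# ⟨
    a · (0# + 0#)     ≡⟨ cong (a ·_) (+-identityˡ 0#) ⟩
    a · 0#            ∎)

  ·-zeroˡ : ∀ a → 0# · a ≡ 0#
  ·-zeroˡ a = identityʳ-unique (0# · a) (0# · a) (begin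
    0# · a + 0# · a   ≡⟨ distribʳ 0# 0# a ⟨
    (0# + 0#) · a     ≡⟨ cong (_· a) (+-identityˡ 0#) ⟩
    0# · a            ∎)

  ·-distribˡ-- : ∀ a b c → a · (b - c) ≡ a · b - a · c
  ·-distribˡ-- a b c =
    x≈z//y (a · (b - c)) (a · c) (a · b)
      (trans (sym (distribˡ a (b - c) c)) (cong (a ·_) (//-rightDividesˡ c b)))

  ·-distribʳ-- : ∀ a b c → (b - c) · a ≡ b · a - c · a
  ·-distribʳ-- a b c =
    x≈z//y ((b - c) · a) (c · a) (b · a)
      (trans (sym (distribʳ (b - c) c a)) (cong (_· a) (//-rightDividesˡ c b)))

  ·-cancelʳ : ∀ {d} → d ≢ 0# → ∀ x y → x · d ≡ y · d → x ≡ y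
  ·-cancelʳ {d} d≢0 x y xd≡yd with right-div d (y · d) d≢0
  ... | _ , _ , unique = trans (unique x xd≡yd) (sym (unique y refl))

module CommutativeSemifieldPlane (F : Semifield) (·-comm : IsCommutative F) where
  open Semifield F
  open SemifieldProperties F
  open ≡-Reasoning

  Coord : Set
  Coord = Carrier × Carrier

  Incident : Coord → Coord → Set
  Incident (x , y) (m , c) = y + c ≡ x · m

  color : Coord → Coord → Carrier
  color (x , _) (m , _) = x + m

  turn : Carrier → Coord → Coord
  turn k (u , v) = (k - u , u · (k - u) - v)

  incident-sym : ∀ {P L} → Incident P L → Incident L P
  incident-sym {x , y} {m , c} y+c≡xm = trans (+-comm c y) (trans y+c≡xm (·-comm x m))

  color-sym : ∀ P L → color P L ≡ color L P
  color-sym (x , _) (m , _) = +-comm x m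

  incident-turn : ∀ k P → Incident P (turn k P)
  incident-turn k (u , v) = x+[y-x]≡y v (u · (k - u))

  color-turn : ∀ k P → color P (turn k P) ≡ k
  color-turn k (u , v) = x+[y-x]≡y u k

  turn-uniqueʳ : ∀ {P L} → Incident P L → L ≡ turn (color P L) P
  turn-uniqueʳ {x , y} {m , c} y+c≡xm = cong₂ _,_ m≡[x+m]-x (begin
    c                     ≡⟨ x≈z//y c y (x · m) (trans (+-comm c y) y+c≡xm) ⟩
    x · m - y             ≡⟨ cong (λ z → x · z - y) m≡[x+m]-x ⟩
    x · ((x + m) - x) - y ∎)
    where
    m≡[x+m]-x : m ≡ (x + m) - x
    m≡[x+m]-x = sym (xyx⁻¹≈y x m)

  turn-uniqueˡ : ∀ {P L} → Incident P L → P ≡ turn (color P L) L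
  turn-uniqueˡ {P} {L} PL = trans (turn-uniqueʳ (incident-sym PL)) (cong (λ k → turn k L) (color-sym L P))

  turn-involutive : ∀ k P → turn k (turn k P) ≡ P
  turn-involutive k P =
    sym (trans (turn-uniqueˡ (incident-turn k P)) (cong (λ c → turn c (turn k P)) (color-turn k P)))

  shear : Carrier → Carrier → Coord → Coord
  shear a b (u , v) = (u + (b - a) , v + (a - u) · (b - a))

  turn-turn : ∀ a b P → turn b (turn a P) ≡ shear a b P
  turn-turn a b (u , v) = cong₂ _,_ b-[a-u]≡u+[b-a] (begin
    w · (b - w) - (u · w - v)         ≡⟨ cong₂ (λ s t → w · s - (t - v)) b-[a-u]≡u+[b-a] (·-comm u w) ⟩
    w · (u + d) - (w · u - v)         ≡⟨ cong (_- (w · u - v)) (distribˡ w u d) ⟩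
    (w · u + w · d) - (w · u - v)     ≡⟨ cong ((w · u + w · d) +_) (⁻¹-anti-homo‿- (w · u) v) ⟩
    (w · u + w · d) + (v - w · u)     ≡⟨ xy∙z≈y∙xz (w · u) (w · d) (v - w · u) ⟩
    w · d + (w · u + (v - w · u))     ≡⟨ cong (w · d +_) (x+[y-x]≡y (w · u) v) ⟩
    w · d + v                         ≡⟨ +-comm (w · d) v ⟩
    v + w · d                         ∎)
    where
    w d : Carrier
    w = a - u
    d = b - a
    b-[a-u]≡u+[b-a] : b - (a - u) ≡ u + (b - a)
    b-[a-u]≡u+[b-a] = trans (cong (b +_) (⁻¹-anti-homo‿- a u)) (x∙yz≈y∙xz b u (- a))

  [x+y]z+[x-z]y≡x[z+y] : ∀ x y z → (x + y) · z + (x - z) · y ≡ x · (z + y)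
  [x+y]z+[x-z]y≡x[z+y] x y z = begin
    (x + y) · z + (x - z) · y            ≡⟨ cong₂ _+_ (distribʳ x y z) (·-distribʳ-- y x z) ⟩
    (x · z + y · z) + (x · y - z · y)    ≡⟨ cong (λ t → (x · z + t) + (x · y - z · y)) (·-comm y z) ⟩
    (x · z + z · y) + (x · y - z · y)    ≡⟨ +-assoc (x · z) (z · y) (x · y - z · y) ⟩
    x · z + (z · y + (x · y - z · y))    ≡⟨ cong (x · z +_) (x+[y-x]≡y (z · y) (x · y)) ⟩
    x · z + x · y                        ≡⟨ distribˡ x z y ⟨
    x · (z + y)                          ∎

  shear-∘ : ∀ a b c P → shear a b (shear b c P) ≡ shear a c P
  shear-∘ a b c (u , v) =
    cong₂ _,_ (trans (+-assoc u γ β) (cong (u +_) ([x-y]+[y-z]≡x-z c b a))) (begin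
      (v + (b - u) · γ) + (a - (u + γ)) · β   ≡⟨ +-assoc v _ _ ⟩
      v + ((b - u) · γ + (a - (u + γ)) · β)   ≡⟨ cong₂ (λ s t → v + (s · γ + t · β)) b-u≡w+β a-[u+γ]≡w-γ ⟩
      v + ((w + β) · γ + (w - γ) · β)         ≡⟨ cong (v +_) ([x+y]z+[x-z]y≡x[z+y] w β γ) ⟩
      v + w · (γ + β)                         ≡⟨ cong (λ t → v + w · t) ([x-y]+[y-z]≡x-z c b a) ⟩
      v + w · (c - a)                         ∎)
    where
    w β γ : Carrier
    w = a - u
    β = b - a
    γ = c - b
    b-u≡w+β : b - u ≡ w + β
    b-u≡w+β = trans (sym ([x-y]+[y-z]≡x-z b a u)) (+-comm β w)
    a-[u+γ]≡w-γ : a - (u + γ) ≡ w - γ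
    a-[u+γ]≡w-γ = trans (cong (a +_) (sym (⁻¹-∙-comm u γ))) (sym (+-assoc a (- u) (- γ)))

  turn-six-cycle : ∀ a b c P → turn c (turn b (turn a (turn c (turn b (turn a P))))) ≡ P
  turn-six-cycle a b c P = begin
    turn c (turn b (turn a (turn c (turn b (turn a P)))))
      ≡⟨ cong (turn c) (turn-turn a b (turn c (turn b (turn a P)))) ⟩
    turn c (shear a b (turn c (turn b (turn a P))))
      ≡⟨ cong (λ Q → turn c (shear a b Q)) (turn-turn b c (turn a P)) ⟩
    turn c (shear a b (shear b c (turn a P)))
      ≡⟨ cong (turn c) (shear-∘ a b c (turn a P)) ⟩
    turn c (shear a c (turn a P))
      ≡⟨ cong (turn c) (turn-turn a c (turn a P)) ⟨
    turn c (turn c (turn a (turn a P)))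
      ≡⟨ turn-involutive c (turn a (turn a P)) ⟩
    turn a (turn a P)
      ≡⟨ turn-involutive a P ⟩
    P ∎

  incident-difference : ∀ {x y m c m′ c′} → Incident (x , y) (m , c) → Incident (x , y) (m′ , c′) →
                        x · (m - m′) ≡ c - c′
  incident-difference {x} {y} {m} {c} {m′} {c′} y+c≡xm y+c′≡xm′ = begin
    x · (m - m′)         ≡⟨ ·-distribˡ-- x m m′ ⟩
    x · m - x · m′       ≡⟨ cong₂ _-_ y+c≡xm y+c′≡xm′ ⟨
    (y + c) - (y + c′)   ≡⟨ [x+y]-[x+z]≡y-z y c c′ ⟩
    c - c′               ∎

  lines-meet-once : ∀ {P P′ L L′} → Incident P L → Incident P L′ → Incident P′ L → Incident P′ L′ →
                    L ≢ L′ → P ≡ P′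
  lines-meet-once {x , y} {x′ , y′} {m , c} {m′ , c′} PL PL′ P′L P′L′ L≢L′ =
    cong₂ _,_ x≡x′ (∙-cancelʳ c y y′ (trans PL (trans (cong (_· m) x≡x′) (sym P′L))))
    where
    m≢m′ : m ≢ m′
    m≢m′ m≡m′ = L≢L′ (cong₂ _,_ m≡m′ (∙-cancelˡ y c c′ (trans PL (trans (cong (x ·_) m≡m′) (sym PL′)))))
    x≡x′ : x ≡ x′
    x≡x′ = ·-cancelʳ (λ m-m′≡0 → m≢m′ (x∙y⁻¹≈ε⇒x≈y m m′ m-m′≡0)) x x′
             (trans (incident-difference PL PL′) (sym (incident-difference P′L P′L′)))

  origin : Coord
  origin = (0# , 0#)

  horizontal-incident : ∀ x y → Incident (x , y) (0# , - y)
  horizontal-incident x y = trans (+-inverseʳ y) (sym (·-zeroʳ x))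

  unit-incident : ∀ y → Incident (1# , y) (y , 0#)
  unit-incident y = trans (+-identityʳ y) (sym (·-identityˡ y))

  origin-incident : ∀ m → Incident origin (m , 0#)
  origin-incident m = trans (+-identityˡ 0#) (sym (·-zeroˡ m))

Fin-^2↔× : ∀ {A : Set} {q} → A ↔ Fin q → Fin (q ^ 2) ↔ (A × A)
Fin-^2↔× {q = q} A↔Fin = (↔-sym A↔Fin ×-↔ ↔-sym A↔Fin) ↔-∘
  subst (λ n → Fin n ↔ (Fin q × Fin q)) (cong (q *_) (sym (*-identityʳ q))) Fin.*↔×

module _ {m n k} (C : Configuration m n k) where

  adj-sym : ∀ u v → Adj C u v → Adj C v u
  adj-sym (inj₁ _) (inj₂ _) uv = uv
  adj-sym (inj₂ _) (inj₁ _) uv = uv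

  reach-trans : ∀ {u v w} → Reach C u v → Reach C v w → Reach C u w
  reach-trans here        vw = vw
  reach-trans (step a uv) vw = step a (reach-trans uv vw)

  reach-sym : ∀ {u v} → Reach C u v → Reach C v u
  reach-sym here = here
  reach-sym (step {u} {v} uv vw) = reach-trans (reach-sym vw) (step (adj-sym u v uv) here)

  connected-via : ∀ hub → (∀ v → Reach C v hub) → Connected C
  connected-via hub reach u v = reach-trans (reach u) (reach-sym (reach v))

module FiniteCommutativeSemifieldPlane
  (F : Semifield) (·-comm : IsCommutative F) {q : ℕ} (F↔Fin : HasOrder F q) where
  open Semifield F using (Carrier; 0#; 1#; -_; _+_; _·_)
  open CommutativeSemifieldPlane F ·-comm
  open ≡-Reasoning

  toFin : Carrier → Fin q
  toFin = Inverse.to F↔Fin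

  fromFin : Fin q → Carrier
  fromFin = Inverse.from F↔Fin

  _≟_ : DecidableEquality Carrier
  _≟_ = via-injection (↔⇒↣ F↔Fin) Fin._≟_

  incident? : ∀ P L → Dec (Incident P L)
  incident? (x , y) (m , c) = (y + c) ≟ (x · m)

  coordinates : Fin (q ^ 2) ↔ Coord
  coordinates = Fin-^2↔× F↔Fin

  coords : Fin (q ^ 2) → Coord
  coords = Inverse.to coordinates

  index : Coord → Fin (q ^ 2)
  index = Inverse.from coordinates

  coords-index : ∀ P → coords (index P) ≡ P
  coords-index = Inverse.strictlyInverseˡ coordinates

  index-coords : ∀ i → index (coords i) ≡ i
  index-coords = Inverse.strictlyInverseʳ coordinates

  coords-injective : ∀ {i j} → coords i ≡ coords j → i ≡ j
  coords-injective = Injection.injective (↔⇒↣ coordinates)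

  inc : Fin (q ^ 2) → Fin (q ^ 2) → Bool
  inc i j = ⌊ incident? (coords i) (coords j) ⌋

  T-inc⇒incident : ∀ {i j} → T (inc i j) → Incident (coords i) (coords j)
  T-inc⇒incident {i} {j} = toWitness {a? = incident? (coords i) (coords j)}

  incident⇒T-inc : ∀ {i j} → Incident (coords i) (coords j) → T (inc i j)
  incident⇒T-inc {i} {j} = fromWitness {a? = incident? (coords i) (coords j)}

  index-incident⇒T-inc : ∀ {P L} → Incident P L → T (inc (index P) (index L))
  index-incident⇒T-inc {P} {L} =
    incident⇒T-inc ∘ subst₂ Incident (sym (coords-index P)) (sym (coords-index L))

  neighbor : Fin q → Coord → Fin (q ^ 2)
  neighbor k P = index (turn (fromFin k) P)

  coords-neighbor : ∀ k P → coords (neighbor k P) ≡ turn (fromFin k) P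
  coords-neighbor k P = coords-index (turn (fromFin k) P)

  neighbor-toFin : ∀ {c P j} → coords j ≡ turn c P → neighbor (toFin c) P ≡ j
  neighbor-toFin {c} {P} {j} j≡turn = begin
    index (turn (fromFin (toFin c)) P)  ≡⟨ cong (λ k → index (turn k P)) (Inverse.strictlyInverseʳ F↔Fin c) ⟩
    index (turn c P)                    ≡⟨ cong index j≡turn ⟨
    index (coords j)                    ≡⟨ index-coords j ⟩
    j                                   ∎

  neighbors↔colors : ∀ P (nbr : Fin (q ^ 2) → Bool) →
                     (∀ {i} → T (nbr i) → Incident P (coords i)) →
                     (∀ {i} → Incident P (coords i) → T (nbr i)) →
                     Σ (Fin (q ^ 2)) (T ∘ nbr) ↔ Fin q
  neighbors↔colors P nbr sound complete = mk↔ₛ′ to from to∘from from∘to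
    where
    to : Σ (Fin (q ^ 2)) (T ∘ nbr) → Fin q
    to (i , _) = toFin (color P (coords i))
    from : Fin q → Σ (Fin (q ^ 2)) (T ∘ nbr)
    from k = neighbor k P ,
             complete (subst (Incident P) (sym (coords-neighbor k P)) (incident-turn (fromFin k) P))
    to∘from : ∀ k → to (from k) ≡ k
    to∘from k = begin
      toFin (color P (coords (neighbor k P)))  ≡⟨ cong (toFin ∘ color P) (coords-neighbor k P) ⟩
      toFin (color P (turn (fromFin k) P))     ≡⟨ cong toFin (color-turn (fromFin k) P) ⟩
      toFin (fromFin k)                        ≡⟨ Inverse.strictlyInverseˡ F↔Fin k ⟩
      k                                        ∎
    from∘to : ∀ e → from (to e) ≡ e
    from∘to (i , r) = Σ-≡,≡→≡ (neighbor-toFin (turn-uniqueʳ (sound r)) , T-irrelevant _ _)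

  move : Fin q → Fin (q ^ 2) → Fin (q ^ 2)
  move k i = neighbor k (coords i)

  coords-move : ∀ k i → coords (move k i) ≡ turn (fromFin k) (coords i)
  coords-move k i = coords-neighbor k (coords i)

  edge-move : ∀ {i j} (r : T (inc i j)) →
              let k = toFin (color (coords i) (coords j)) in j ≡ move k i × i ≡ move k j
  edge-move r = sym (neighbor-toFin (turn-uniqueʳ (T-inc⇒incident r))) ,
                sym (neighbor-toFin (turn-uniqueˡ (T-inc⇒incident r)))

  configuration : Configuration (q ^ 2) (q ^ 2) q
  configuration = record
    { inc          = inc
    ; no-digon     = λ p₁ p₂ l₁ l₂ p₁≢p₂ l₁≢l₂ r₁₁ r₁₂ r₂₁ r₂₂ →
        p₁≢p₂ (coords-injective (lines-meet-once (T-inc⇒incident r₁₁) (T-inc⇒incident r₁₂)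
                                                 (T-inc⇒incident r₂₁) (T-inc⇒incident r₂₂)
                                                 (l₁≢l₂ ∘ coords-injective)))
    ; point-degree = λ p → neighbors↔colors (coords p) (inc p) T-inc⇒incident incident⇒T-inc
    ; line-degree  = λ l → neighbors↔colors (coords l) (λ p → inc p l)
                             (incident-sym ∘ T-inc⇒incident) (incident⇒T-inc ∘ incident-sym)
    }

  coloring : EdgeColoring configuration
  coloring = record
    { col             = λ p l _ → toFin (color (coords p) (coords l))
    ; proper-at-point = λ p l l′ r r′ l≢l′ same →
        l≢l′ (trans (proj₁ (edge-move r)) (trans (cong (λ k → move k p) same)
                                                 (sym (proj₁ (edge-move r′)))))
    ; proper-at-line  = λ l p p′ r r′ p≢p′ same →
        p≢p′ (trans (proj₂ (edge-move r)) (trans (cong (λ k → move k l) same)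
                                                 (sym (proj₂ (edge-move r′)))))
    }

  open EdgeColoring coloring using (Step; SixCycle)

  hop : Fin q → Vertex configuration → Vertex configuration
  hop k (inj₁ p) = inj₂ (move k p)
  hop k (inj₂ l) = inj₁ (move k l)

  step⇒hop : ∀ k v w → Step k v w → w ≡ hop k v
  step⇒hop k (inj₁ p) (inj₂ l) (r , refl) = cong inj₂ (proj₁ (edge-move r))
  step⇒hop k (inj₂ l) (inj₁ p) (r , refl) = cong inj₁ (proj₂ (edge-move r))

  move-six-cycle : ∀ a b c i → move c (move b (move a (move c (move b (move a i))))) ≡ i
  move-six-cycle a b c i =
    coords-injective (trans (along (along (along (along (along (along refl)))))) (turn-six-cycle _ _ _ (coords i)))
    where
    along : ∀ {k j Q} → coords j ≡ Q → coords (move k j) ≡ turn (fromFin k) Q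
    along {k} {j} e = trans (coords-move k j) (cong (turn (fromFin k)) e)

  hop-six-cycle : ∀ a b c v → hop c (hop b (hop a (hop c (hop b (hop a v))))) ≡ v
  hop-six-cycle a b c (inj₁ p) = cong inj₁ (move-six-cycle a b c p)
  hop-six-cycle a b c (inj₂ l) = cong inj₂ (move-six-cycle a b c l)

  six-cycle : SixCycle
  six-cycle a b c _ _ _ v v₁ v₂ v₃ v₄ v₅ v₆ s₁ s₂ s₃ s₄ s₅ s₆
    with refl ← step⇒hop a v v₁ s₁ | refl ← step⇒hop b v₁ v₂ s₂ | refl ← step⇒hop c v₂ v₃ s₃
       | refl ← step⇒hop a v₃ v₄ s₄ | refl ← step⇒hop b v₄ v₅ s₅ | refl ← step⇒hop c v₅ v₆ s₆
    = hop-six-cycle a b c v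

  point-reaches-origin : ∀ P → Reach configuration (inj₁ (index P)) (inj₁ (index origin))
  point-reaches-origin (x , y) =
    step {v = inj₂ (index (0# , - y))} (index-incident⇒T-inc (horizontal-incident x y))
    (step {v = inj₁ (index (1# , y))}  (index-incident⇒T-inc (horizontal-incident 1# y))
    (step {v = inj₂ (index (y , 0#))}  (index-incident⇒T-inc (unit-incident y))
    (step (index-incident⇒T-inc (origin-incident y)) here)))

  line-reaches-origin : ∀ L → Reach configuration (inj₂ (index L)) (inj₁ (index origin))
  line-reaches-origin (m , c) =
    step {v = inj₁ (index (0# , - c))} (index-incident⇒T-inc (incident-sym (horizontal-incident m c)))
         (point-reaches-origin (0# , - c))

  reaches-origin : ∀ v → Reach configuration v (inj₁ (index origin))
  reaches-origin (inj₁ p) =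
    subst (λ i → Reach configuration (inj₁ i) _) (index-coords p) (point-reaches-origin (coords p))
  reaches-origin (inj₂ l) =
    subst (λ i → Reach configuration (inj₂ i) _) (index-coords l) (line-reaches-origin (coords l))

  coloredConfiguration : ColoredConfiguration (q ^ 2) (q ^ 2) q
  coloredConfiguration = record
    { config    = configuration
    ; connected = connected-via configuration (inj₁ (index origin)) reaches-origin
    ; coloring  = coloring
    ; six-cycle = six-cycle
    }

theorem7p3 : (q : ℕ) (F : Semifield) → IsCommutative F → HasOrder F q →
    ColoredConfiguration (q ^ 2) (q ^ 2) q
theorem7p3 q F ·-comm F↔Fin = FiniteCommutativeSemifieldPlane.coloredConfiguration F ·-comm F↔Fin
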